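{- For every odd $k\geq5$ and every integer $d\geq2$ there exists a bipartite Cayley digraph of order $2(k-1)\left(\lfloor\frac{d}{2}\rfloor\right)^{k-1}$, degree $d$ and diameter at most $k$.
   Context: A Cayley digraph $Cay(\Gamma,X)$ of a group $\Gamma$ with respect to a generating set $X$ not containing the identity has vertex set $\Gamma$ and an arc from $u$ to $v$ iff $ux=v$ for some $x\in X$; its degree is $|X|$ and its order is $|\Gamma|$. It is bipartite if its vertex set can be partitioned into two parts such that every arc joins vertices in different parts. The diameter is the maximum directed distance between vertices. -}

module Defs where

open import Data.Nat using (ℕ; zero; suc; _+_; _*_; _≤_)
open import Data.Fin using (Fin)
open import Data.Fin.Subset using (Subset; _∈_)
open import Data.Bool using (Bool)
open import Data.Product using (Σ; _×_; ∃)
open import Relation.Binary.PropositionalEquality using (_≡_; _≢_)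

Odd : ℕ → Set
Odd k = ∃ λ m → k ≡ 2 * m + 1

Digraph : ℕ → Set₁
Digraph n = Fin n → Fin n → Set

data Walk {n : ℕ} (A : Digraph n) : Fin n → Fin n → ℕ → Set where
  here : ∀ {u} → Walk A u u 0
  step : ∀ {u v w m} → A u v → Walk A v w m → Walk A u w (suc m)

DiameterAtMost : ∀ {n} → Digraph n → ℕ → Set
DiameterAtMost {n} A k = (u v : Fin n) → ∃ λ m → m ≤ k × Walk A u v m

Bipartite : ∀ {n} → Digraph n → Set
Bipartite {n} A = Σ (Fin n → Bool) λ c → (u v : Fin n) → A u v → c u ≢ c v

Cay : ∀ {n} → (Fin n → Fin n → Fin n) → Subset n → Digraph n
Cay _∙_ X u v = ∃ λ x → x ∈ X × u ∙ x ≡ v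

data Generated {n : ℕ} (_∙_ : Fin n → Fin n → Fin n) (ε : Fin n)
               (_⁻¹ : Fin n → Fin n) (X : Subset n) : Fin n → Set where
  gen-ε   : Generated _∙_ ε _⁻¹ X ε
  gen-x   : ∀ {g x} → x ∈ X → Generated _∙_ ε _⁻¹ X g → Generated _∙_ ε _⁻¹ X (g ∙ x)
  gen-inv : ∀ {g x} → x ∈ X → Generated _∙_ ε _⁻¹ X g → Generated _∙_ ε _⁻¹ X (g ∙ (x ⁻¹))

Generates : ∀ {n} → (Fin n → Fin n → Fin n) → Fin n → (Fin n → Fin n) → Subset n → Set
Generates {n} _∙_ ε _⁻¹ X = (g : Fin n) → Generated _∙_ ε _⁻¹ X g

-- With n = k − 1 (even) and m = ⌊d/2⌋, take Γ = ℤ₂ × (ℤₘ ≀ ℤₙ), of order 2 n mⁿ: a side bit, a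
-- pointer on the n-cycle and a lamp value in ℤₘ at every vertex. The generators flip the side,
-- add an arbitrary value to the lamp under the pointer and then move the pointer by 1 or 2, for
-- 2m generators, plus one that does not move the pointer when d is odd. Since every generator
-- flips the side, the Cayley digraph is bipartite. To get from u to w, follow a word of n steps
-- of sizes 1 and 2 that stops exactly once at every vertex of the cycle and ends where the
-- pointer of w is, setting each lamp to its value in w on the way. As n is even, this word ends
-- on the side of u; when w is on the other side, one preliminary step of size 1 is taken, for at
-- most n + 1 = k steps.

module Submission where

open import Defs
open import Data.Nat using (ℕ; _≤_; _*_; _∸_; _^_; _/_)
open import Data.Fin using (Fin)
open import Data.Fin.Subset using (Subset; _∉_; ∣_∣)
open import Data.Product using (Σ; _×_)
open import Relation.Binary.PropositionalEquality using (_≡_)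
open import Algebra.Structures using (IsGroup)

open import Algebra.Bundles using (AbelianGroup)
open import Algebra.Bundles.Raw using (RawGroup)
open import Algebra.Morphism.Structures using (module GroupMorphisms)
open GroupMorphisms using (IsGroupMonomorphism)
import Algebra.Morphism.GroupMonomorphism as GroupMonomorphism
open import Algebra.Structures using (IsAbelianGroup)
open import Data.Bool using (Bool; true; false)
open import Data.Fin using (zero; suc; toℕ; _≟_; combine; remQuot; finToFun; funToFin)
open import Data.Fin.Properties
  using (toℕ-fromℕ<; toℕ-injective; toℕ<n; remQuot-combine; combine-remQuot; finToFun-funToFin; funToFin-finToFin)
open import Data.Fin.Subset using (_∈_; ⊥; inside; outside)
open import Data.Fin.Subset.Properties using (∉⊥; ∣⊥∣≡0)
open import Data.List using (List; []; _∷_; [_]; _++_; _∷ʳ_; length; map; replicate; take; allFin; cartesianProduct)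
open import Data.List.Properties using (length-++; length-map; length-take; length-tabulate; length-replicate)
open import Data.List.Membership.Propositional using () renaming (_∈_ to _∈ₗ_)
open import Data.List.Membership.Propositional.Properties
  using (∈-map⁺; ∈-map⁻; ∈-++⁺ˡ; ∈-cartesianProduct⁺; ∈-cartesianProduct⁻; ∈-allFin)
open import Data.List.Relation.Binary.Disjoint.Propositional using (Disjoint)
open import Data.List.Relation.Unary.All as All using (All)
import Data.List.Relation.Unary.All.Properties as All
open import Data.List.Relation.Unary.AllPairs as AllPairs using ()
open import Data.List.Relation.Unary.Any using (here; there)
open import Data.List.Relation.Unary.Unique.Propositional using (Unique)
import Data.List.Relation.Unary.Unique.Propositional.Properties as Unique
open import Data.List.Reverse as Reverse using (Reverse; _∶_∶ʳ_; reverseView)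
open import Data.Nat as ℕ using (zero; suc; NonZero; _<_; z≤n; s≤s; _%_)
import Data.Nat.Properties as ℕ
open import Data.Nat.DivMod
  using (_mod_; _divMod_; result; m%n<n; m≡m%n+[m/n]*n; m<n⇒m%n≡m; n%n≡0; [m+n]%n≡m%n; [m+kn]%n≡m%n; /-monoˡ-≤)
open import Data.Nat.Divisibility using (_∣_; divides)
open import Data.Nat.ListAction using (sum)
open import Data.Nat.ListAction.Properties using (sum-++)
open import Data.Nat.Tactic.RingSolver using (solve)
open import Data.Product using (∃; _,_; proj₁; proj₂; uncurry)
open import Data.Sum using (_⊎_; inj₁; inj₂) renaming ([_,_]′ to either)
open import Data.Vec as Vec using (_[_]≔_)
open import Data.Vec.Properties using ([]≔-updates; []≔-minimal; lookup∘update′; []=⇒lookup; lookup⇒[]=)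
open import Function using (_∘_; id)
open import Relation.Binary.PropositionalEquality
  using (_≢_; _≗_; refl; sym; trans; cong; cong₂; subst; subst₂; isEquivalence; module ≡-Reasoning)
open import Relation.Binary.Structures using (IsEquivalence)
open import Relation.Nullary using (yes; no; contradiction)

[m+n%d]%d≡[m+n]%d : ∀ m n d .⦃ _ : NonZero d ⦄ → (m ℕ.+ n % d) % d ≡ (m ℕ.+ n) % d
[m+n%d]%d≡[m+n]%d m n d = begin
  (m ℕ.+ n % d) % d                   ≡⟨ [m+kn]%n≡m%n (m ℕ.+ n % d) (n / d) d ⟨
  (m ℕ.+ n % d ℕ.+ n / d * d) % d     ≡⟨ cong (_% d) (ℕ.+-assoc m (n % d) (n / d * d)) ⟩
  (m ℕ.+ (n % d ℕ.+ n / d * d)) % d   ≡⟨ cong (λ k → (m ℕ.+ k) % d) (m≡m%n+[m/n]*n n d) ⟨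
  (m ℕ.+ n) % d                       ∎
  where open ≡-Reasoning

module ℤMod (n : ℕ) .⦃ _ : NonZero n ⦄ where

  infixl 6 _+_ _+ℕ_
  infix  8 -_

  _+ℕ_ : Fin n → ℕ → Fin n
  x +ℕ a = (toℕ x ℕ.+ a) mod n

  _+_ : Fin n → Fin n → Fin n
  x + y = x +ℕ toℕ y

  -_ : Fin n → Fin n
  - x = (n ℕ.∸ toℕ x) mod n

  0# : Fin n
  0# = 0 mod n

  toℕ-mod : ∀ a → toℕ (a mod n) ≡ a % n
  toℕ-mod a = toℕ-fromℕ< (m%n<n a n)

  mod-cong : ∀ {a b} → a % n ≡ b % n → a mod n ≡ b mod n
  mod-cong {a} {b} eq = toℕ-injective (trans (toℕ-mod a) (trans eq (sym (toℕ-mod b))))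

  mod-toℕ : ∀ x → toℕ x mod n ≡ x
  mod-toℕ x = toℕ-injective (trans (toℕ-mod (toℕ x)) (m<n⇒m%n≡m (toℕ<n x)))

  mod-injective : ∀ {a b} → a < n → b < n → a mod n ≡ b mod n → a ≡ b
  mod-injective {a} {b} a<n b<n eq = begin
    a          ≡⟨ m<n⇒m%n≡m a<n ⟨
    a % n      ≡⟨ toℕ-mod a ⟨
    toℕ (a mod n) ≡⟨ cong toℕ eq ⟩
    toℕ (b mod n) ≡⟨ toℕ-mod b ⟩
    b % n      ≡⟨ m<n⇒m%n≡m b<n ⟩
    b          ∎
    where open ≡-Reasoning

  +ℕ-% : ∀ x a → x +ℕ a % n ≡ x +ℕ a
  +ℕ-% x a = mod-cong ([m+n%d]%d≡[m+n]%d (toℕ x) a n)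

  +ℕ-assoc : ∀ x a b → x +ℕ a +ℕ b ≡ x +ℕ (a ℕ.+ b)
  +ℕ-assoc x a b = mod-cong (begin
    (toℕ ((toℕ x ℕ.+ a) mod n) ℕ.+ b) % n ≡⟨ cong (λ c → (c ℕ.+ b) % n) (toℕ-mod (toℕ x ℕ.+ a)) ⟩
    ((toℕ x ℕ.+ a) % n ℕ.+ b) % n         ≡⟨ cong (_% n) (ℕ.+-comm ((toℕ x ℕ.+ a) % n) b) ⟩
    (b ℕ.+ (toℕ x ℕ.+ a) % n) % n         ≡⟨ [m+n%d]%d≡[m+n]%d b (toℕ x ℕ.+ a) n ⟩
    (b ℕ.+ (toℕ x ℕ.+ a)) % n             ≡⟨ cong (_% n) (ℕ.+-comm b (toℕ x ℕ.+ a)) ⟩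
    (toℕ x ℕ.+ a ℕ.+ b) % n               ≡⟨ cong (_% n) (ℕ.+-assoc (toℕ x) a b) ⟩
    (toℕ x ℕ.+ (a ℕ.+ b)) % n             ∎)
    where open ≡-Reasoning

  +ℕ-identityʳ : ∀ x → x +ℕ 0 ≡ x
  +ℕ-identityʳ x = trans (cong (_mod n) (ℕ.+-identityʳ (toℕ x))) (mod-toℕ x)

  +ℕ-+*n : ∀ x a k → x +ℕ (a ℕ.+ k * n) ≡ x +ℕ a
  +ℕ-+*n x a k = mod-cong (trans (cong (_% n) (sym (ℕ.+-assoc (toℕ x) a (k * n))))
                                 ([m+kn]%n≡m%n (toℕ x ℕ.+ a) k n))

  +ℕ-n+ : ∀ x a → x +ℕ (n ℕ.+ a) ≡ x +ℕ a
  +ℕ-n+ x a = mod-cong (begin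
    (toℕ x ℕ.+ (n ℕ.+ a)) % n ≡⟨ cong (λ k → (toℕ x ℕ.+ k) % n) (ℕ.+-comm n a) ⟩
    (toℕ x ℕ.+ (a ℕ.+ n)) % n ≡⟨ cong (_% n) (ℕ.+-assoc (toℕ x) a n) ⟨
    (toℕ x ℕ.+ a ℕ.+ n) % n   ≡⟨ [m+n]%n≡m%n (toℕ x ℕ.+ a) n ⟩
    (toℕ x ℕ.+ a) % n         ∎)
    where open ≡-Reasoning

  +-mod : ∀ x a → x + a mod n ≡ x +ℕ a
  +-mod x a = trans (cong (x +ℕ_) (toℕ-mod a)) (+ℕ-% x a)

  +-assoc : ∀ x y z → x + y + z ≡ x + (y + z)
  +-assoc x y z = trans (+ℕ-assoc x (toℕ y) (toℕ z)) (sym (+-mod x (toℕ y ℕ.+ toℕ z)))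

  +-comm : ∀ x y → x + y ≡ y + x
  +-comm x y = cong (_mod n) (ℕ.+-comm (toℕ x) (toℕ y))

  +-identityʳ : ∀ x → x + 0# ≡ x
  +-identityʳ x = trans (+-mod x 0) (+ℕ-identityʳ x)

  +-inverseʳ : ∀ x → x + - x ≡ 0#
  +-inverseʳ x = begin
    x + - x                   ≡⟨ +-mod x (n ℕ.∸ toℕ x) ⟩
    (toℕ x ℕ.+ (n ℕ.∸ toℕ x)) mod n ≡⟨ cong (_mod n) (ℕ.m+[n∸m]≡n (ℕ.<⇒≤ (toℕ<n x))) ⟩
    n mod n                   ≡⟨ mod-cong (trans (n%n≡0 n) (sym (m<n⇒m%n≡m (ℕ.>-nonZero⁻¹ n)))) ⟩
    0#                        ∎
    where open ≡-Reasoning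

  +-isAbelianGroup : IsAbelianGroup _≡_ _+_ 0# -_
  +-isAbelianGroup = record
    { isGroup = record
      { isMonoid = record
        { isSemigroup = record
          { isMagma = record { isEquivalence = isEquivalence ; ∙-cong = cong₂ _+_ }
          ; assoc = +-assoc
          }
        ; identity = (λ x → trans (+-comm 0# x) (+-identityʳ x)) , +-identityʳ
        }
      ; inverse = (λ x → trans (+-comm (- x) x) (+-inverseʳ x)) , +-inverseʳ
      ; ⁻¹-cong = cong -_
      }
    ; comm = +-comm
    }

  +-abelianGroup : AbelianGroup _ _
  +-abelianGroup = record { isAbelianGroup = +-isAbelianGroup }

  open import Algebra.Properties.AbelianGroup +-abelianGroup public
    using () renaming (⁻¹-involutive to -‿involutive; ⁻¹-∙-comm to -‿+-comm; ε⁻¹≈ε to -0#≡0#; x∙y⁻¹≈ε⇒x≈y to x-y≡0⇒x≡y)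
  open AbelianGroup +-abelianGroup public
    using () renaming (identityˡ to +-identityˡ; inverseˡ to +-inverseˡ)

  x-y+y≡x : ∀ x y → x + - y + y ≡ x
  x-y+y≡x x y = trans (+-assoc x (- y) y) (trans (cong (x +_) (+-inverseˡ y)) (+-identityʳ x))

  x-[y+z]≡x-y-z : ∀ x y z → x + - (y + z) ≡ x + - y + - z
  x-[y+z]≡x-y-z x y z = trans (cong (x +_) (sym (-‿+-comm y z))) (sym (+-assoc x (- y) (- z)))

  x+[y-x]≡y : ∀ x y → x + (y + - x) ≡ y
  x+[y-x]≡y x y = begin
    x + (y + - x) ≡⟨ cong (x +_) (+-comm y (- x)) ⟩
    x + (- x + y) ≡⟨ +-assoc x (- x) y ⟨
    x + - x + y   ≡⟨ cong (_+ y) (+-inverseʳ x) ⟩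
    0# + y        ≡⟨ +-identityˡ y ⟩
    y             ∎
    where open ≡-Reasoning

ℤ₂-cases : ∀ x y → y ≡ ℤMod._+ℕ_ 2 x 0 ⊎ y ≡ ℤMod._+ℕ_ 2 x 1
ℤ₂-cases zero       zero       = inj₁ refl
ℤ₂-cases zero       (suc zero) = inj₂ refl
ℤ₂-cases (suc zero) zero       = inj₂ refl
ℤ₂-cases (suc zero) (suc zero) = inj₁ refl

colour : Fin 2 → Bool
colour zero    = false
colour (suc _) = true

colour-+ℕ1 : ∀ x → colour x ≢ colour (ℤMod._+ℕ_ 2 x 1)
colour-+ℕ1 zero       ()
colour-+ℕ1 (suc zero) ()

module StepWords where

  open import Data.Nat using (_+_)

  -- Visits ss o: the walk with step sizes ss, started at 0, is at o before one of its steps.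
  data Visits : List ℕ → ℕ → Set where
    start : ∀ {s ss} → Visits (s ∷ ss) 0
    next  : ∀ {s ss o} → Visits ss o → Visits (s ∷ ss) (s + o)

  Visits-++ʳ : ∀ xs {ys o} → Visits ys o → Visits (xs ++ ys) (sum xs + o)
  Visits-++ʳ []       v = v
  Visits-++ʳ (x ∷ xs) {o = o} v = subst (Visits _) (sym (ℕ.+-assoc x (sum xs) o)) (next (Visits-++ʳ xs v))

  Visits-replicate-++ : ∀ {j l s ts} → l ≤ j → Visits ts 0 → Visits (replicate j s ++ ts) (l * s)
  Visits-replicate-++ {zero}          z≤n       v = v
  Visits-replicate-++ {suc j} {zero}  _         _ = start
  Visits-replicate-++ {suc j} {suc l} (s≤s l≤j) v = next (Visits-replicate-++ l≤j v)

  Visits-∷ʳ⁻ : ∀ ss {s o} → Visits (ss ∷ʳ s) o → Visits ss o ⊎ o ≡ sum ss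
  Visits-∷ʳ⁻ []       start    = inj₂ refl
  Visits-∷ʳ⁻ (x ∷ ss) start    = inj₁ start
  Visits-∷ʳ⁻ (x ∷ ss) (next v) with Visits-∷ʳ⁻ ss v
  ... | inj₁ v′ = inj₁ (next v′)
  ... | inj₂ eq = inj₂ (cong (x +_) eq)

  sum-replicate : ∀ j s → sum (replicate j s) ≡ j * s
  sum-replicate zero    s = refl
  sum-replicate (suc j) s = cong (s +_) (sum-replicate j s)

  -- The blocks of 2ʲ 1ᵃ 2ʲ (1 + r) stop at the even offsets below 2j, at 2j, …, 2j + a − 1, and at
  -- 2j + a + 2l (l ≤ j), which modulo 2j + a + 1 are 2j + a and the odd offsets below 2j.
  word : ℕ → ℕ → ℕ → List ℕ
  word j a r = replicate j 2 ++ replicate a 1 ++ replicate j 2 ++ [ suc r ]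

  All-word : ∀ {P : ℕ → Set} j a {r} → P 1 → P 2 → r ≤ 1 → All P (word j a r)
  All-word {P} j a p₁ p₂ r≤1 =
    All.++⁺ (All.replicate⁺ j p₂)
            (All.++⁺ (All.replicate⁺ a p₁) (All.++⁺ (All.replicate⁺ j p₂) (last r≤1 All.∷ All.[])))
    where
    last : ∀ {r} → r ≤ 1 → P (suc r)
    last z≤n       = p₁
    last (s≤s z≤n) = p₂

  length-word : ∀ j a r → length (word j a r) ≡ suc (j * 2 + a)
  length-word j a r = begin
    length (word j a r)   ≡⟨ length-++ (replicate j 2) ⟩
    length (replicate j 2) + length (replicate a 1 ++ replicate j 2 ++ [ suc r ])
      ≡⟨ cong (length (replicate j 2) +_) (length-++ (replicate a 1)) ⟩
    length (replicate j 2) + (length (replicate a 1) + length (replicate j 2 ++ [ suc r ]))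
      ≡⟨ cong (λ k → length (replicate j 2) + (length (replicate a 1) + k)) (length-++ (replicate j 2)) ⟩
    length (replicate j 2) + (length (replicate a 1) + (length (replicate j 2) + 1))
      ≡⟨ cong₂ (λ x y → x + (y + (x + 1))) (length-replicate j) (length-replicate a) ⟩
    j + (a + (j + 1))     ≡⟨ solve (j ∷ a ∷ []) ⟩
    suc (j * 2 + a)       ∎
    where open ≡-Reasoning

  sum-word : ∀ j a r → sum (word j a r) ≡ suc (j * 2 + a) + (r + j * 2)
  sum-word j a r = begin
    sum (word j a r)
      ≡⟨ sum-++ (replicate j 2) _ ⟩
    sum (replicate j 2) + sum (replicate a 1 ++ replicate j 2 ++ [ suc r ])
      ≡⟨ cong (sum (replicate j 2) +_) (sum-++ (replicate a 1) _) ⟩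
    sum (replicate j 2) + (sum (replicate a 1) + sum (replicate j 2 ++ [ suc r ]))
      ≡⟨ cong (λ k → sum (replicate j 2) + (sum (replicate a 1) + k)) (sum-++ (replicate j 2) _) ⟩
    sum (replicate j 2) + (sum (replicate a 1) + (sum (replicate j 2) + (suc r + 0)))
      ≡⟨ cong₂ (λ x y → x + (y + (x + (suc r + 0)))) (sum-replicate j 2) (sum-replicate a 1) ⟩
    j * 2 + (a * 1 + (j * 2 + (suc r + 0)))
      ≡⟨ solve (j ∷ a ∷ r ∷ []) ⟩
    suc (j * 2 + a) + (r + j * 2) ∎
    where open ≡-Reasoning

  word-covers : ∀ j a r {o} → o < suc (j * 2 + a) →
                Visits (word j a r) o ⊎ Visits (word j a r) (suc (j * 2 + a) + o)
  word-covers j a r {o} o<len with o ℕ.<? j * 2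
  ... | no o≮2j = inj₁ (subst (Visits (word j a r)) offset
                         (Visits-++ʳ (replicate j 2) (Visits-replicate-++ l≤a (Visits-replicate-++ z≤n start))))
    where
    l = o ℕ.∸ j * 2
    offset : sum (replicate j 2) + l * 1 ≡ o
    offset = trans (cong₂ _+_ (sum-replicate j 2) (ℕ.*-identityʳ l)) (ℕ.m+[n∸m]≡n (ℕ.≮⇒≥ o≮2j))
    l≤a : l ≤ a
    l≤a = subst (l ≤_) (ℕ.m+n∸m≡n (j * 2) a) (ℕ.∸-monoˡ-≤ (j * 2) (ℕ.≤-pred o<len))
  ... | yes o<2j with o divMod 2
  ...   | result l zero refl = inj₁ (Visits-replicate-++ (ℕ.<⇒≤ (ℕ.*-cancelʳ-< 2 l j o<2j))
                                  (Visits-replicate-++ {a} z≤n (Visits-replicate-++ {j} z≤n start)))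
  ...   | result l (suc zero) refl = inj₂ (subst (Visits (word j a r)) offset
            (Visits-++ʳ (replicate j 2) (Visits-++ʳ (replicate a 1)
              (Visits-replicate-++ (ℕ.*-cancelʳ-≤ (suc l) j 2 o<2j) start))))
    where
    offset : sum (replicate j 2) + (sum (replicate a 1) + suc l * 2) ≡ suc (j * 2 + a) + suc (l * 2)
    offset = begin
      sum (replicate j 2) + (sum (replicate a 1) + suc l * 2)
        ≡⟨ cong₂ (λ x y → x + (y + suc l * 2)) (sum-replicate j 2) (sum-replicate a 1) ⟩
      j * 2 + (a * 1 + suc l * 2) ≡⟨ solve (j ∷ a ∷ l ∷ []) ⟩
      suc (j * 2 + a) + suc (l * 2) ∎
      where open ≡-Reasoning

  record Tour (n q : ℕ) : Set where
    field
      steps         : List ℕ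
      steps-1-or-2  : All (λ s → s ≡ 1 ⊎ s ≡ 2) steps
      length-steps  : length steps ≡ n
      sum-steps     : sum steps ≡ n + q
      covers        : ∀ {o} → o < n → Visits steps o ⊎ Visits steps (n + o)

  word-tour : ∀ j a {r} → r ≤ 1 → Tour (suc (j * 2 + a)) (r + j * 2)
  word-tour j a {r} r≤1 = record
    { steps        = word j a r
    ; steps-1-or-2 = All-word j a (inj₁ refl) (inj₂ refl) r≤1
    ; length-steps = length-word j a r
    ; sum-steps    = sum-word j a r
    ; covers       = word-covers j a r
    }

  tour : ∀ {n q} → q < n → Tour n q
  tour {n} {q} q<n with q divMod 2
  ... | result j r refl =
    subst (λ k → Tour k q) (ℕ.m+[n∸m]≡n 2j<n) (word-tour j (n ℕ.∸ suc (j * 2)) (ℕ.≤-pred (toℕ<n r)))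
    where
    2j<n : j * 2 < n
    2j<n = ℕ.≤-<-trans (ℕ.m≤n+m (j * 2) (toℕ r)) q<n

open StepWords

fromList : ∀ {N} → List (Fin N) → Subset N
fromList []       = ⊥
fromList (x ∷ xs) = fromList xs [ x ]≔ inside

∈-fromList⁺ : ∀ {N} {x : Fin N} {xs} → x ∈ₗ xs → x ∈ fromList xs
∈-fromList⁺ {xs = y ∷ ys} (here refl) = []≔-updates (fromList ys) y
∈-fromList⁺ {x = x} {xs = y ∷ ys} (there x∈ys) with x ≟ y
... | yes refl = []≔-updates (fromList ys) y
... | no  x≢y  = []≔-minimal (fromList ys) x y x≢y (∈-fromList⁺ x∈ys)

∈-fromList⁻ : ∀ {N} {x : Fin N} {xs} → x ∈ fromList xs → x ∈ₗ xs
∈-fromList⁻ {xs = []}     x∈ = contradiction x∈ ∉⊥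
∈-fromList⁻ {x = x} {xs = y ∷ ys} x∈ with x ≟ y
... | yes x≡y = here x≡y
... | no  x≢y = there (∈-fromList⁻ (lookup⇒[]= x (fromList ys)
                  (trans (sym (lookup∘update′ x≢y (fromList ys) inside)) ([]=⇒lookup x∈))))

∣[]≔inside∣ : ∀ {N} (S : Subset N) x → x ∉ S → ∣ S [ x ]≔ inside ∣ ≡ suc ∣ S ∣
∣[]≔inside∣ (inside  Vec.∷ S) zero    x∉ = contradiction Vec.here x∉
∣[]≔inside∣ (outside Vec.∷ S) zero    _  = refl
∣[]≔inside∣ (inside  Vec.∷ S) (suc x) x∉ = cong suc (∣[]≔inside∣ S x (x∉ ∘ Vec.there))
∣[]≔inside∣ (outside Vec.∷ S) (suc x) x∉ = ∣[]≔inside∣ S x (x∉ ∘ Vec.there)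

∣fromList∣ : ∀ {N} {xs : List (Fin N)} → Unique xs → ∣ fromList xs ∣ ≡ length xs
∣fromList∣ {N} AllPairs.[]               = ∣⊥∣≡0 N
∣fromList∣ {xs = x ∷ _} (x∉xs AllPairs.∷ u) =
  trans (∣[]≔inside∣ _ x (λ x∈ → All.lookup x∉xs (∈-fromList⁻ x∈) refl)) (cong suc (∣fromList∣ u))

BipartiteCayleyDigraph : ℕ → ℕ → ℕ → Set
BipartiteCayleyDigraph N d k =
  Σ (Fin N → Fin N → Fin N) λ _∙_ → Σ (Fin N) λ ε → Σ (Fin N → Fin N) λ _⁻¹ →
  IsGroup _≡_ _∙_ ε _⁻¹ ×
  Σ (Subset N) λ X →
    ε ∉ X × ∣ X ∣ ≡ d × Generates _∙_ ε _⁻¹ X × Bipartite (Cay _∙_ X) × DiameterAtMost (Cay _∙_ X) k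

Walk⇒Generated : ∀ {N} {_∙_ : Fin N → Fin N → Fin N} {ε _⁻¹ X u v k} →
                 Generated _∙_ ε _⁻¹ X u → Walk (Cay _∙_ X) u v k → Generated _∙_ ε _⁻¹ X v
Walk⇒Generated g here                        = g
Walk⇒Generated g (step (_ , x∈X , refl) walk) = Walk⇒Generated (gen-x x∈X g) walk

Walk-∷ʳ : ∀ {k} {A : Digraph k} {u v w ℓ} → Walk A u v ℓ → A v w → Walk A u w (ℓ ℕ.+ 1)
Walk-∷ʳ here         arc = step arc here
Walk-∷ʳ (step a wk)  arc = step a (Walk-∷ʳ wk arc)

length-cartesianProduct : ∀ {A B : Set} (xs : List A) (ys : List B) →
                          length (cartesianProduct xs ys) ≡ length xs * length ys
length-cartesianProduct []       ys = refl
length-cartesianProduct (x ∷ xs) ys = trans (length-++ (map (x ,_) ys))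
  (cong₂ ℕ._+_ (length-map (x ,_) ys) (length-cartesianProduct xs ys))

funToFin-cong : ∀ {a b} {f g : Fin a → Fin b} → f ≗ g → funToFin f ≡ funToFin g
funToFin-cong {zero}  f≗g = refl
funToFin-cong {suc a} f≗g = cong₂ combine (f≗g zero) (funToFin-cong (f≗g ∘ suc))

module Lamplighter (n m : ℕ) .⦃ _ : NonZero n ⦄ .⦃ _ : NonZero m ⦄ where

  private
    module ℤ₂ = ℤMod 2
    module ℤₙ = ℤMod n
    module ℤₘ = ℤMod m

  record Γ : Set where
    constructor ⟨_,_,_⟩
    field
      side    : Fin 2
      pointer : Fin n
      lamp    : Fin n → Fin m

  open Γ public

  infix 4 _≈_
  _≈_ : Γ → Γ → Set
  g ≈ h = side g ≡ side h × pointer g ≡ pointer h × lamp g ≗ lamp h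

  infixl 7 _·_
  _·_ : Γ → Γ → Γ
  ⟨ s , t , f ⟩ · ⟨ s′ , t′ , f′ ⟩ = ⟨ s ℤ₂.+ s′ , t ℤₙ.+ t′ , (λ i → f i ℤₘ.+ f′ (i ℤₙ.+ ℤₙ.- t)) ⟩

  e : Γ
  e = ⟨ ℤ₂.0# , ℤₙ.0# , (λ _ → ℤₘ.0#) ⟩

  infix 8 _⁻¹
  _⁻¹ : Γ → Γ
  ⟨ s , t , f ⟩ ⁻¹ = ⟨ ℤ₂.- s , ℤₙ.- t , (λ i → ℤₘ.- f (i ℤₙ.+ t)) ⟩

  ≈-isEquivalence : IsEquivalence _≈_
  ≈-isEquivalence = record
    { refl  = refl , refl , (λ _ → refl)
    ; sym   = λ (s≡ , t≡ , f≗) → sym s≡ , sym t≡ , sym ∘ f≗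
    ; trans = λ (s≡ , t≡ , f≗) (s≡′ , t≡′ , f≗′) → trans s≡ s≡′ , trans t≡ t≡′ , λ i → trans (f≗ i) (f≗′ i)
    }

  open IsEquivalence ≈-isEquivalence using () renaming (refl to ≈-refl; sym to ≈-sym; trans to ≈-trans)

  ·-cong : ∀ {g g′ h h′} → g ≈ g′ → h ≈ h′ → g · h ≈ g′ · h′
  ·-cong {g′ = ⟨ _ , _ , f ⟩} {h′ = ⟨ _ , _ , f′ ⟩} (s≡ , refl , f≗) (s≡′ , t≡′ , f≗′) =
    cong₂ ℤ₂._+_ s≡ s≡′ , cong (_ ℤₙ.+_) t≡′ , λ i → cong₂ ℤₘ._+_ (f≗ i) (f≗′ _)

  ⁻¹-cong : ∀ {g h} → g ≈ h → g ⁻¹ ≈ h ⁻¹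
  ⁻¹-cong (s≡ , refl , f≗) = cong ℤ₂.-_ s≡ , refl , λ i → cong ℤₘ.-_ (f≗ _)

  ·-assoc : ∀ g h k → (g · h) · k ≈ g · (h · k)
  ·-assoc ⟨ s₁ , t₁ , f₁ ⟩ ⟨ s₂ , t₂ , f₂ ⟩ ⟨ s₃ , t₃ , f₃ ⟩ =
    ℤ₂.+-assoc s₁ s₂ s₃ , ℤₙ.+-assoc t₁ t₂ t₃ , λ i →
      trans (ℤₘ.+-assoc (f₁ i) (f₂ (i ℤₙ.+ ℤₙ.- t₁)) _)
            (cong (λ j → f₁ i ℤₘ.+ (f₂ (i ℤₙ.+ ℤₙ.- t₁) ℤₘ.+ f₃ j)) (ℤₙ.x-[y+z]≡x-y-z i t₁ t₂))

  ·-identityˡ : ∀ g → e · g ≈ g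
  ·-identityˡ ⟨ s , t , f ⟩ = ℤ₂.+-identityˡ s , ℤₙ.+-identityˡ t , λ i →
    trans (ℤₘ.+-identityˡ _) (cong f (trans (cong (i ℤₙ.+_) ℤₙ.-0#≡0#) (ℤₙ.+-identityʳ i)))

  ·-identityʳ : ∀ g → g · e ≈ g
  ·-identityʳ ⟨ s , t , f ⟩ = ℤ₂.+-identityʳ s , ℤₙ.+-identityʳ t , λ i → ℤₘ.+-identityʳ (f i)

  ·-inverseˡ : ∀ g → g ⁻¹ · g ≈ e
  ·-inverseˡ ⟨ s , t , f ⟩ = ℤ₂.+-inverseˡ s , ℤₙ.+-inverseˡ t , λ i →
    trans (cong (λ j → ℤₘ.- f (i ℤₙ.+ t) ℤₘ.+ f (i ℤₙ.+ j)) (ℤₙ.-‿involutive t)) (ℤₘ.+-inverseˡ _)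

  ·-inverseʳ : ∀ g → g · g ⁻¹ ≈ e
  ·-inverseʳ ⟨ s , t , f ⟩ = ℤ₂.+-inverseʳ s , ℤₙ.+-inverseʳ t , λ i →
    trans (cong (λ j → f i ℤₘ.+ ℤₘ.- f j) (ℤₙ.x-y+y≡x i t)) (ℤₘ.+-inverseʳ (f i))

  ·-isGroup : IsGroup _≈_ _·_ e _⁻¹
  ·-isGroup = record
    { isMonoid = record
      { isSemigroup = record
        { isMagma = record { isEquivalence = ≈-isEquivalence ; ∙-cong = ·-cong }
        ; assoc = ·-assoc
        }
      ; identity = ·-identityˡ , ·-identityʳ
      }
    ; inverse = ·-inverseˡ , ·-inverseʳ
    ; ⁻¹-cong = ⁻¹-cong
    }

  order : ℕ
  order = 2 * n * m ^ n

  encode : Γ → Fin order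
  encode ⟨ s , t , f ⟩ = combine (combine s t) (funToFin f)

  decode : Fin order → Γ
  decode x = let st , f = remQuot (m ^ n) x ; s , t = remQuot n st in ⟨ s , t , finToFun f ⟩

  decode-encode : ∀ g → decode (encode g) ≈ g
  decode-encode ⟨ s , t , f ⟩ = cong proj₁ st≡ , cong proj₂ st≡ , λ i →
    trans (cong (λ y → finToFun (proj₂ y) i) outer≡) (finToFun-funToFin f i)
    where
    outer≡ : remQuot (m ^ n) (encode ⟨ s , t , f ⟩) ≡ (combine s t , funToFin f)
    outer≡ = remQuot-combine (combine s t) (funToFin f)
    st≡ : remQuot n (proj₁ (remQuot (m ^ n) (encode ⟨ s , t , f ⟩))) ≡ (s , t)
    st≡ = trans (cong (remQuot n ∘ proj₁) outer≡) (remQuot-combine s t)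

  encode-decode : ∀ x → encode (decode x) ≡ x
  encode-decode x = trans (cong₂ combine (combine-remQuot {2} n st) (funToFin-finToFin {n} {m} f))
                          (combine-remQuot {2 * n} (m ^ n) x)
    where
    st : Fin (2 * n)
    st = proj₁ (remQuot (m ^ n) x)
    f : Fin (m ^ n)
    f = proj₂ (remQuot {2 * n} (m ^ n) x)

  encode-cong : ∀ {g h} → g ≈ h → encode g ≡ encode h
  encode-cong {⟨ s , t , _ ⟩} (refl , refl , f≗) = cong (combine (combine s t)) (funToFin-cong f≗)

  decode-injective : ∀ {x y} → decode x ≈ decode y → x ≡ y
  decode-injective {x} {y} eq = trans (sym (encode-decode x)) (trans (encode-cong eq) (encode-decode y))

  encode-injective : ∀ {g h} → encode g ≡ encode h → g ≈ h
  encode-injective {g} {h} eq =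
    ≈-trans (≈-sym (decode-encode g)) (subst (λ x → decode x ≈ h) (sym eq) (decode-encode h))

  infixl 7 _∙_
  _∙_ : Fin order → Fin order → Fin order
  x ∙ y = encode (decode x · decode y)

  ε : Fin order
  ε = encode e

  infix 8 _⁻¹′
  _⁻¹′ : Fin order → Fin order
  x ⁻¹′ = encode (decode x ⁻¹)

  ·-rawGroup ∙-rawGroup : RawGroup _ _
  ·-rawGroup = record { _≈_ = _≈_ ; _∙_ = _·_ ; ε = e ; _⁻¹ = _⁻¹ }
  ∙-rawGroup = record { _≈_ = _≡_ ; _∙_ = _∙_ ; ε = ε ; _⁻¹ = _⁻¹′ }

  decode-isGroupMonomorphism : IsGroupMonomorphism ∙-rawGroup ·-rawGroup decode
  decode-isGroupMonomorphism = record
    { isGroupHomomorphism = record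
      { isMonoidHomomorphism = record
        { isMagmaHomomorphism = record
          { isRelHomomorphism = record { cong = λ { refl → ≈-refl } }
          ; homo = λ x y → decode-encode (decode x · decode y)
          }
        ; ε-homo = decode-encode e
        }
      ; ⁻¹-homo = λ x → decode-encode (decode x ⁻¹)
      }
    ; injective = decode-injective
    }

  ∙-isGroup : IsGroup _≡_ _∙_ ε _⁻¹′
  ∙-isGroup = GroupMonomorphism.isGroup decode-isGroupMonomorphism ·-isGroup

  decode-∙-encode : ∀ u g → decode (u ∙ encode g) ≈ decode u · g
  decode-∙-encode u g = ≈-trans (decode-encode (decode u · decode (encode g)))
                                (·-cong {decode u} {decode u} ≈-refl (decode-encode g))

  δ : Fin m → Fin n → Fin m
  δ a i with i ≟ ℤₙ.0#
  ... | yes _ = a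
  ... | no  _ = ℤₘ.0#

  δ-0# : ∀ a → δ a ℤₙ.0# ≡ a
  δ-0# a with ℤₙ.0# ≟ ℤₙ.0#
  ... | yes _   = refl
  ... | no  0≢0 = contradiction refl 0≢0

  -- Right multiplication by gen t a adds a to the lamp under the pointer, then moves the pointer by t.
  gen : Fin n → Fin m → Γ
  gen t a = ⟨ suc zero , t , δ a ⟩

  lamp-·gen-pointer : ∀ g t a → lamp (g · gen t a) (pointer g) ≡ lamp g (pointer g) ℤₘ.+ a
  lamp-·gen-pointer ⟨ _ , t , f ⟩ _ a with t ℤₙ.+ ℤₙ.- t ≟ ℤₙ.0#
  ... | yes _    = refl
  ... | no  t≢t = contradiction (ℤₙ.+-inverseʳ t) t≢t

  lamp-·gen-≢ : ∀ g t a {i} → i ≢ pointer g → lamp (g · gen t a) i ≡ lamp g i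
  lamp-·gen-≢ ⟨ _ , t , f ⟩ _ a {i} i≢t with i ℤₙ.+ ℤₙ.- t ≟ ℤₙ.0#
  ... | yes i-t≡0 = contradiction (ℤₙ.x-y≡0⇒x≡y i t i-t≡0) i≢t
  ... | no  _     = ℤₘ.+-identityʳ (f i)

  encode-gen-injective : ∀ {p q} → encode (uncurry gen p) ≡ encode (uncurry gen q) → p ≡ q
  encode-gen-injective {t , a} {t′ , a′} eq = cong₂ _,_ t≡t′ (trans (sym (δ-0# a)) (trans (a≗a′ ℤₙ.0#) (δ-0# a′)))
    where
    t≡t′ : t ≡ t′
    t≡t′ = proj₁ (proj₂ (encode-injective {gen t a} {gen t′ a′} eq))
    a≗a′ : δ a ≗ δ a′
    a≗a′ = proj₂ (proj₂ (encode-injective {gen t a} {gen t′ a′} eq))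

  module Sweeping (X : Subset order) where

    Allowed : ℕ → Set
    Allowed s = ∀ a → encode (gen (s mod n) a) ∈ X

    record Sweep (u : Fin order) (ss : List ℕ) (V : Fin n → Fin m) : Set where
      field
        end         : Fin order
        walk        : Walk (Cay _∙_ X) u end (length ss)
        side-end    : side (decode end) ≡ side (decode u) ℤ₂.+ℕ length ss
        pointer-end : pointer (decode end) ≡ pointer (decode u) ℤₙ.+ℕ sum ss
        lamp-end    : ∀ {o} → Visits ss o →
                      lamp (decode end) (pointer (decode u) ℤₙ.+ℕ o) ≡ V (pointer (decode u) ℤₙ.+ℕ o)

    Sweep-[] : ∀ u V → Sweep u [] V
    Sweep-[] u V = record
      { end         = u
      ; walk        = here
      ; side-end    = sym (ℤ₂.+ℕ-identityʳ _)
      ; pointer-end = sym (ℤₙ.+ℕ-identityʳ _)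
      ; lamp-end    = λ ()
      }

    -- The sweep is built from its last step: that step sets the lamp under the pointer to its target
    -- value and changes no other lamp, so the values written before survive.
    Sweep-∷ʳ : ∀ {u ss V s} → Sweep u ss V → Allowed s → Sweep u (ss ∷ʳ s) V
    Sweep-∷ʳ {u} {ss} {V} {s} sw allowed = record
      { end         = end ∙ encode (gen (s mod n) a)
      ; walk        = subst (Walk (Cay _∙_ X) u _) (sym (length-++ ss)) (Walk-∷ʳ walk (_ , allowed a , refl))
      ; side-end    = begin
          side (decode (end ∙ encode (gen (s mod n) a))) ≡⟨ proj₁ moved ⟩
          side g ℤ₂.+ℕ 1                         ≡⟨ cong (ℤ₂._+ℕ 1) side-end ⟩
          side (decode u) ℤ₂.+ℕ length ss ℤ₂.+ℕ 1 ≡⟨ ℤ₂.+ℕ-assoc (side (decode u)) (length ss) 1 ⟩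
          side (decode u) ℤ₂.+ℕ (length ss ℕ.+ 1) ≡⟨ cong (side (decode u) ℤ₂.+ℕ_) (length-++ ss) ⟨
          side (decode u) ℤ₂.+ℕ length (ss ∷ʳ s) ∎
      ; pointer-end = begin
          pointer (decode (end ∙ encode (gen (s mod n) a))) ≡⟨ proj₁ (proj₂ moved) ⟩
          pointer g ℤₙ.+ s mod n                    ≡⟨ ℤₙ.+-mod (pointer g) s ⟩
          pointer g ℤₙ.+ℕ s                         ≡⟨ cong (ℤₙ._+ℕ s) pointer-end ⟩
          t₀ ℤₙ.+ℕ sum ss ℤₙ.+ℕ s                   ≡⟨ ℤₙ.+ℕ-assoc t₀ (sum ss) s ⟩
          t₀ ℤₙ.+ℕ (sum ss ℕ.+ s)                   ≡⟨ cong (λ k → t₀ ℤₙ.+ℕ (sum ss ℕ.+ k)) (ℕ.+-identityʳ s) ⟨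
          t₀ ℤₙ.+ℕ (sum ss ℕ.+ (s ℕ.+ 0))           ≡⟨ cong (t₀ ℤₙ.+ℕ_) (sum-++ ss [ s ]) ⟨
          t₀ ℤₙ.+ℕ sum (ss ∷ʳ s)                    ∎
      ; lamp-end    = λ {o} visits → trans (proj₂ (proj₂ moved) (t₀ ℤₙ.+ℕ o)) (written visits)
      }
      where
      open ≡-Reasoning
      open Sweep sw
      t₀ = pointer (decode u)
      g = decode end
      a = V (pointer g) ℤₘ.+ ℤₘ.- lamp g (pointer g)
      moved : decode (end ∙ encode (gen (s mod n) a)) ≈ g · gen (s mod n) a
      moved = decode-∙-encode end (gen (s mod n) a)
      written : ∀ {o} → Visits (ss ∷ʳ s) o → lamp (g · gen (s mod n) a) (t₀ ℤₙ.+ℕ o) ≡ V (t₀ ℤₙ.+ℕ o)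
      written {o} visits with t₀ ℤₙ.+ℕ o ≟ pointer g
      ... | yes i≡t = begin
        lamp (g · gen (s mod n) a) (t₀ ℤₙ.+ℕ o)                         ≡⟨ cong (lamp (g · gen (s mod n) a)) i≡t ⟩
        lamp (g · gen (s mod n) a) (pointer g)                          ≡⟨ lamp-·gen-pointer g (s mod n) a ⟩
        lamp g (pointer g) ℤₘ.+ (V (pointer g) ℤₘ.+ ℤₘ.- lamp g (pointer g)) ≡⟨ ℤₘ.x+[y-x]≡y _ _ ⟩
        V (pointer g)                                           ≡⟨ cong V i≡t ⟨
        V (t₀ ℤₙ.+ℕ o)                                          ∎
      ... | no  i≢t with Visits-∷ʳ⁻ ss visits
      ...   | inj₁ visits′ = trans (lamp-·gen-≢ g (s mod n) a i≢t) (lamp-end visits′)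
      ...   | inj₂ refl    = contradiction (sym pointer-end) i≢t

    sweep : ∀ {ss} → All Allowed ss → ∀ u V → Sweep u ss V
    sweep {ss} allowed u V = go (reverseView ss) allowed
      where
      go : ∀ {ss} → Reverse ss → All Allowed ss → Sweep u ss V
      go Reverse.[]     _       = Sweep-[] u V
      go (_ ∶ r ∶ʳ _) allowed = let allowed-init , allowed-last = All.∷ʳ⁻ allowed in
                                   Sweep-∷ʳ (go r allowed-init) allowed-last

    reach : Allowed 1 → Allowed 2 → ∀ {pre} → All (λ s → s ≡ 1 ⊎ s ≡ 2) pre → ∀ u w →
            side (decode w) ≡ side (decode u) ℤ₂.+ℕ (length pre ℕ.+ n) →
            Walk (Cay _∙_ X) u w (length pre ℕ.+ n)
    reach allowed₁ allowed₂ {pre} pre-1-or-2 u w side-w =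
      subst₂ (Walk (Cay _∙_ X) u) (decode-injective end≈w) length-ss walk
      where
      open ≡-Reasoning
      t₀ = pointer (decode u)
      t′ = t₀ ℤₙ.+ℕ sum pre
      offset : Fin n → ℕ
      offset i = toℕ (i ℤₙ.+ ℤₙ.- t′)
      open Tour (tour {q = offset (pointer (decode w))} (toℕ<n _))
      ss = pre ++ steps
      allowed : All Allowed ss
      allowed = All.map 1-or-2⇒allowed (All.++⁺ pre-1-or-2 steps-1-or-2)
        where
        1-or-2⇒allowed : ∀ {s} → s ≡ 1 ⊎ s ≡ 2 → Allowed s
        1-or-2⇒allowed (inj₁ refl) = allowed₁
        1-or-2⇒allowed (inj₂ refl) = allowed₂
      open Sweep (sweep allowed u (lamp (decode w)))
      length-ss : length ss ≡ length pre ℕ.+ n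
      length-ss = trans (length-++ pre) (cong (length pre ℕ.+_) length-steps)
      from-t′ : ∀ o → t₀ ℤₙ.+ℕ (sum pre ℕ.+ o) ≡ t′ ℤₙ.+ℕ o
      from-t′ o = sym (ℤₙ.+ℕ-assoc t₀ (sum pre) o)
      lands : ∀ i → t′ ℤₙ.+ℕ offset i ≡ i
      lands i = ℤₙ.x+[y-x]≡y t′ i
      pointer-w : pointer (decode end) ≡ pointer (decode w)
      pointer-w = begin
        pointer (decode end)                    ≡⟨ pointer-end ⟩
        t₀ ℤₙ.+ℕ sum ss
          ≡⟨ cong (t₀ ℤₙ.+ℕ_) (trans (sum-++ pre steps) (cong (sum pre ℕ.+_) sum-steps)) ⟩
        t₀ ℤₙ.+ℕ (sum pre ℕ.+ (n ℕ.+ offset (pointer (decode w)))) ≡⟨ from-t′ _ ⟩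
        t′ ℤₙ.+ℕ (n ℕ.+ offset (pointer (decode w)))              ≡⟨ ℤₙ.+ℕ-n+ t′ _ ⟩
        t′ ℤₙ.+ℕ offset (pointer (decode w))    ≡⟨ lands (pointer (decode w)) ⟩
        pointer (decode w)                      ∎
      lamp-w : ∀ i → lamp (decode end) i ≡ lamp (decode w) i
      lamp-w i = either
        (λ visits → visited (Visits-++ʳ pre visits) (trans (from-t′ _) (lands i)))
        (λ visits → visited (Visits-++ʳ pre visits) (trans (from-t′ _) (trans (ℤₙ.+ℕ-n+ t′ _) (lands i))))
        (covers (toℕ<n (i ℤₙ.+ ℤₙ.- t′)))
        where
        visited : ∀ {o} → Visits ss o → t₀ ℤₙ.+ℕ o ≡ i → lamp (decode end) i ≡ lamp (decode w) i
        visited visits refl = lamp-end visits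
      end≈w : decode end ≈ decode w
      end≈w = trans side-end (trans (cong (side (decode u) ℤ₂.+ℕ_) length-ss) (sym side-w)) , pointer-w , lamp-w

    -- A tour has even length n, so it ends on the side of u; a first step of size 1 changes sides.
    diameter≤1+n : Allowed 1 → Allowed 2 → 2 ∣ n → DiameterAtMost (Cay _∙_ X) (suc n)
    diameter≤1+n allowed₁ allowed₂ (divides h n≡h*2) u w = walk-by (ℤ₂-cases s (side (decode w)))
      where
      s = side (decode u)
      parity : ∀ a → s ℤ₂.+ℕ (a ℕ.+ n) ≡ s ℤ₂.+ℕ a
      parity a = trans (cong (λ k → s ℤ₂.+ℕ (a ℕ.+ k)) n≡h*2) (ℤ₂.+ℕ-+*n s a h)
      walk-by : side (decode w) ≡ s ℤ₂.+ℕ 0 ⊎ side (decode w) ≡ s ℤ₂.+ℕ 1 →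
                ∃ λ k → k ≤ suc n × Walk (Cay _∙_ X) u w k
      walk-by (inj₁ same) = n , ℕ.n≤1+n n ,
        reach allowed₁ allowed₂ All.[] u w (trans same (sym (parity 0)))
      walk-by (inj₂ flip) = suc n , ℕ.≤-refl ,
        reach allowed₁ allowed₂ (inj₁ refl All.∷ All.[]) u w (trans flip (sym (parity 1)))

  moves : List (Fin n)
  moves = 1 mod n ∷ 2 mod n ∷ []

  -- (pointer move, lamp value) of each generator; the r extra ones, with move 0, fix the parity of the degree.
  pairs : ℕ → List (Fin n × Fin m)
  pairs r = cartesianProduct moves (allFin m) ++ map (ℤₙ.0# ,_) (take r (allFin m))

  generators : ℕ → List (Fin order)
  generators r = map (encode ∘ uncurry gen) (pairs r)

  pairs-unique : 3 ≤ n → ∀ r → Unique (pairs r)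
  pairs-unique 3≤n r = Unique.++⁺ (Unique.cartesianProduct⁺ moves-unique (Unique.allFin⁺ m))
                                  (Unique.map⁺ (cong proj₂) (Unique.take⁺ r (Unique.allFin⁺ m)))
                                  0∉moves
    where
    distinct : ∀ {a b} → a < 3 → b < 3 → a ≢ b → a mod n ≢ b mod n
    distinct a<3 b<3 a≢b = a≢b ∘ ℤₙ.mod-injective (ℕ.<-≤-trans a<3 3≤n) (ℕ.<-≤-trans b<3 3≤n)
    moves-unique : Unique moves
    moves-unique = (distinct (s≤s (s≤s z≤n)) ℕ.≤-refl (λ ()) All.∷ All.[]) AllPairs.∷ All.[] AllPairs.∷ AllPairs.[]
    0∉moves : Disjoint (cartesianProduct moves (allFin m)) (map (ℤₙ.0# ,_) (take r (allFin m)))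
    0∉moves (p∈A , p∈B) with ∈-map⁻ (ℤₙ.0# ,_) p∈B
    ... | _ , _ , refl with proj₁ (∈-cartesianProduct⁻ moves (allFin m) p∈A)
    ...   | here         0≡1 = distinct (s≤s z≤n) (s≤s (s≤s z≤n)) (λ ()) 0≡1
    ...   | there (here 0≡2) = distinct (s≤s z≤n) ℕ.≤-refl (λ ()) 0≡2

  length-pairs : ∀ {r} → r ≤ m → length (pairs r) ≡ 2 * m ℕ.+ r
  length-pairs {r} r≤m = begin
    length (pairs r)
      ≡⟨ length-++ (cartesianProduct moves (allFin m)) ⟩
    length (cartesianProduct moves (allFin m)) ℕ.+ length (map (ℤₙ.0# ,_) (take r (allFin m)))
      ≡⟨ cong₂ ℕ._+_ (length-cartesianProduct moves (allFin m)) (length-map (ℤₙ.0# ,_) (take r (allFin m))) ⟩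
    2 * length (allFin m) ℕ.+ length (take r (allFin m))
      ≡⟨ cong₂ (λ x y → 2 * x ℕ.+ y) length-allFin (length-take r (allFin m)) ⟩
    2 * m ℕ.+ r ℕ.⊓ length (allFin m) ≡⟨ cong (λ y → 2 * m ℕ.+ r ℕ.⊓ y) length-allFin ⟩
    2 * m ℕ.+ r ℕ.⊓ m                 ≡⟨ cong (2 * m ℕ.+_) (ℕ.m≤n⇒m⊓n≡m r≤m) ⟩
    2 * m ℕ.+ r                       ∎
    where
    open ≡-Reasoning
    length-allFin : length (allFin m) ≡ m
    length-allFin = length-tabulate {n = m} id

  side-generator : ∀ {r x} → x ∈ₗ generators r → side (decode x) ≡ suc zero
  side-generator x∈ with ∈-map⁻ (encode ∘ uncurry gen) x∈
  ... | p , _ , refl = proj₁ (decode-encode (uncurry gen p))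

  move∈generators : ∀ r {t} → t ∈ₗ moves → ∀ a → encode (gen t a) ∈ₗ generators r
  move∈generators r t∈moves a = ∈-map⁺ (encode ∘ uncurry gen) (∈-++⁺ˡ (∈-cartesianProduct⁺ t∈moves (∈-allFin a)))

  bipartiteCayleyDigraph : 3 ≤ n → 2 ∣ n → ∀ r → r ≤ 1 → BipartiteCayleyDigraph order (2 * m ℕ.+ r) (suc n)
  bipartiteCayleyDigraph 3≤n 2∣n r r≤1 =
    _∙_ , ε , _⁻¹′ , ∙-isGroup , X , ε∉X , ∣X∣≡d , generates , bipartite , diameter
    where
    X : Subset order
    X = fromList (generators r)
    open Sweeping X
    allowed : ∀ {s} → s mod n ∈ₗ moves → Allowed s
    allowed s∈moves a = ∈-fromList⁺ (move∈generators r s∈moves a)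
    diameter : DiameterAtMost (Cay _∙_ X) (suc n)
    diameter = diameter≤1+n (allowed (here refl)) (allowed (there (here refl))) 2∣n
    ε∉X : ε ∉ X
    ε∉X ε∈X with trans (sym (proj₁ (decode-encode e))) (side-generator (∈-fromList⁻ ε∈X))
    ... | ()
    ∣X∣≡d : ∣ X ∣ ≡ 2 * m ℕ.+ r
    ∣X∣≡d = trans (∣fromList∣ (Unique.map⁺ encode-gen-injective (pairs-unique 3≤n r)))
                  (trans (length-map _ (pairs r)) (length-pairs (ℕ.≤-trans r≤1 (ℕ.>-nonZero⁻¹ m))))
    generates : Generates _∙_ ε _⁻¹′ X
    generates g = Walk⇒Generated gen-ε (proj₂ (proj₂ (diameter ε g)))
    bipartite : Bipartite (Cay _∙_ X)
    bipartite = colour ∘ side ∘ decode , λ { u _ (x , x∈X , refl) same →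
      colour-+ℕ1 (side (decode u)) (trans same (cong colour (side-∙ u x∈X))) }
      where
      side-∙ : ∀ u {x} → x ∈ X → side (decode (u ∙ x)) ≡ side (decode u) ℤ₂.+ℕ 1
      side-∙ u {x} x∈X = trans (proj₁ (decode-encode (decode u · decode x)))
                               (cong (side (decode u) ℤ₂.+_) (side-generator (∈-fromList⁻ x∈X)))

corollary3 : (k d : ℕ) → Odd k → 5 ≤ k → 2 ≤ d →
    Σ (Fin (2 * (k ∸ 1) * (d / 2) ^ (k ∸ 1)) → Fin (2 * (k ∸ 1) * (d / 2) ^ (k ∸ 1)) → Fin (2 * (k ∸ 1) * (d / 2) ^ (k ∸ 1))) λ _∙_ →
    Σ (Fin (2 * (k ∸ 1) * (d / 2) ^ (k ∸ 1))) λ ε →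
    Σ (Fin (2 * (k ∸ 1) * (d / 2) ^ (k ∸ 1)) → Fin (2 * (k ∸ 1) * (d / 2) ^ (k ∸ 1))) λ _⁻¹ →
    IsGroup _≡_ _∙_ ε _⁻¹ ×
    Σ (Subset (2 * (k ∸ 1) * (d / 2) ^ (k ∸ 1))) λ X →
      ε ∉ X × ∣ X ∣ ≡ d × Generates _∙_ ε _⁻¹ X ×
      Bipartite (Cay _∙_ X) × DiameterAtMost (Cay _∙_ X) k
corollary3 k d (h , k≡2h+1) 5≤k 2≤d =
  subst₂ (BipartiteCayleyDigraph _) degree diameter
    (Lamplighter.bipartiteCayleyDigraph (k ∸ 1) (d / 2) 3≤k-1 (divides h k-1≡h*2) (d % 2) (ℕ.≤-pred (m%n<n d 2)))
  where
  3≤k-1 : 3 ≤ k ∸ 1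
  3≤k-1 = ℕ.≤-trans (ℕ.n≤1+n 3) (ℕ.∸-monoˡ-≤ 1 5≤k)
  instance
    k-1≢0 : NonZero (k ∸ 1)
    k-1≢0 = ℕ.>-nonZero (ℕ.<-≤-trans (s≤s z≤n) 3≤k-1)
    d/2≢0 : NonZero (d / 2)
    d/2≢0 = ℕ.>-nonZero (/-monoˡ-≤ 2 2≤d)
  k-1≡h*2 : k ∸ 1 ≡ h * 2
  k-1≡h*2 = trans (cong (_∸ 1) k≡2h+1) (trans (ℕ.m+n∸n≡m (2 * h) 1) (ℕ.*-comm 2 h))
  degree : 2 * (d / 2) ℕ.+ d % 2 ≡ d
  degree = trans (ℕ.+-comm (2 * (d / 2)) (d % 2))
                 (trans (cong (d % 2 ℕ.+_) (ℕ.*-comm 2 (d / 2))) (sym (m≡m%n+[m/n]*n d 2)))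
  diameter : suc (k ∸ 1) ≡ k
  diameter = ℕ.m+[n∸m]≡n (ℕ.≤-trans (s≤s z≤n) 5≤k)
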